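{- Let $\mathbf A=\langle A,+,',1\rangle$ be a 0-commutative orthogroupoid, $e$ a central element of $\mathbf A$, and $c\in A_e$. Then $c$ is a central element of $\mathbf A$ if and only if $c$ is a central element of $\mathbf A_e$.
   Context: An orthogroupoid is an algebra $\langle A,+,',1\rangle$ of type $(2,1,0)$, with $0:=1'$, satisfying: (a) $x''\approx x$; (b) $0+x\approx x$ and $x+1\approx 1$; (c) $x+x'\approx 1$; (d) for all $x,z$: if $x+z=z$ and $x'+z=z$ then $z=1$; (e) $(((z+y)'+(z+x))'+(z+y)')+z'\approx z'$; (f) $x+(x+y)\approx x+y$ and $y+(x+y)\approx x+y$. It is 0-commutative if it satisfies $x+0\approx 0+x$. Define $x\cdot y:=(x'+y')'$, $q(x,y,z)=(x+z)\cdot(x'+y)$ and $x\wedge y:=q(x,y,0)$; the 0-commutative orthogroupoids form a Church variety with respect to $q$ and the constants $0,1$ ($q(1,x,y)=x$, $q(0,x,y)=y$). An element $e$ of such an algebra is central if the principal congruences $\theta(e,0)$ and $\theta(e,1)$ (where $0,1$ are the algebra's constant $1$ and its involution image) form a pair of factor congruences (their intersection is the identity and their composition is the full relation). For a central $e$, $\mathbf A_e$ is the algebra of the same type with universe $A_e=\{e\wedge b:b\in A\}$ and operations $g_e(e\wedge b_1,\dots,e\wedge b_n)=e\wedge g(e\wedge b_1,\dots,e\wedge b_n)$ for each basic operation $g$ (so its constant is $e\wedge 1=e$); the map $b\mapsto e\wedge b$ is a homomorphism of $\mathbf A$ onto $\mathbf A_e$, so $\mathbf A_e$ is again a 0-commutative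 orthogroupoid, and $\mathbf A\cong\mathbf A_e\times\mathbf A_{e'}$. -}

module Defs where

open import Level using (Level; _⊔_; suc)
open import Data.Product using (Σ; Σ-syntax; ∃; _×_; _,_)
open import Data.Unit.Polymorphic using (⊤)
open import Relation.Binary.PropositionalEquality using (_≡_)

record ZeroCommOrthogroupoid (ℓ : Level) : Set (suc ℓ) where
  infixl 6 _+_
  infix 8 _′
  field
    Carrier : Set ℓ
    _+_     : Carrier → Carrier → Carrier
    _′      : Carrier → Carrier
    one     : Carrier

  zero : Carrier
  zero = one ′

  field
    involutive : ∀ x → (x ′) ′ ≡ x
    zero-+     : ∀ x → zero + x ≡ x
    +-one      : ∀ x → x + one ≡ one
    +-compl    : ∀ x → x + x ′ ≡ one
    quasi      : ∀ x z → x + z ≡ z → x ′ + z ≡ z → z ≡ one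
    axiom-e    : ∀ x y z →
                 (((z + y) ′ + (z + x)) ′ + (z + y) ′) + z ′ ≡ z ′
    absorb₁    : ∀ x y → x + (x + y) ≡ x + y
    absorb₂    : ∀ x y → y + (x + y) ≡ x + y
    zero-comm  : ∀ x → x + zero ≡ zero + x

  infixl 7 _·_
  _·_ : Carrier → Carrier → Carrier
  x · y = (x ′ + y ′) ′

  q : Carrier → Carrier → Carrier → Carrier
  q x y z = (x + z) · (x ′ + y)

  infixl 7 _∧_
  _∧_ : Carrier → Carrier → Carrier
  x ∧ y = q x y zero

-- Generic notions for an algebra of type (2,1,0) whose universe is a
-- subset U of a carrier A (U = everything for A itself, U = A_e for A_e),
-- with operations _+_, _′ (closed on U) and constant o.

module _ {ℓ : Level} {A : Set ℓ} (U : A → Set ℓ)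
         (_+_ : A → A → A) (_′ : A → A) (o : A) where

  -- Principal congruence θ(a,b): the least equivalence relation on U
  -- containing (a,b) and compatible with the basic operations
  -- (compatibility with the constant is just reflexivity).
  data Θ (a b : A) : A → A → Set ℓ where
    gen   : Θ a b a b
    θrefl : ∀ {x} → U x → Θ a b x x
    θsym  : ∀ {x y} → Θ a b x y → Θ a b y x
    θtrans : ∀ {x y z} → Θ a b x y → Θ a b y z → Θ a b x z
    θ+    : ∀ {x y u v} → Θ a b x y → Θ a b u v → Θ a b (x + u) (y + v)
    θ′    : ∀ {x y} → Θ a b x y → Θ a b (x ′) (y ′)

  FactorPair : (A → A → Set ℓ) → (A → A → Set ℓ) → Set ℓ
  FactorPair R S =
    (∀ x y → U x → U y → R x y → S x y → x ≡ y) ×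
    (∀ x y → U x → U y → Σ[ z ∈ A ] (U z × R x z × S z y))

  IsCentral : A → Set ℓ
  IsCentral e = FactorPair (Θ e (o ′)) (Θ e o)

module _ {ℓ : Level} (𝐀 : ZeroCommOrthogroupoid ℓ) where
  open ZeroCommOrthogroupoid 𝐀

  Central : Carrier → Set ℓ
  Central = IsCentral (λ _ → ⊤) _+_ _′ one

  InAₑ : Carrier → Carrier → Set ℓ
  InAₑ e x = Σ[ b ∈ Carrier ] x ≡ e ∧ b

  _+ₑ_ : Carrier → Carrier → Carrier → Carrier
  (e +ₑ x) y = e ∧ (x + y)

  ′ₑ : Carrier → Carrier → Carrier
  ′ₑ e x = e ∧ (x ′)

  oneₑ : Carrier → Carrier
  oneₑ e = e ∧ one

  Centralₑ : Carrier → Carrier → Set ℓ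
  Centralₑ e = IsCentral (InAₑ e) (e +ₑ_) (′ₑ e) (oneₑ e)

-- If e is central, a term in the variable e (possibly using e ∧ _ and e′ ∧ _)
-- is determined by its values at 0 and 1, because θ(e,0) ∩ θ(e,1) is the
-- identity. This shows that b ↦ e ∧ b and b ↦ e′ ∧ b are homomorphisms onto
-- A_e and A_e′, that b is determined by the pair (e ∧ b, e′ ∧ b), and that
-- q is a Church term for A_e. Now let c ∈ A_e. The restriction to A_e of a
-- congruence of A is a congruence of A_e, and c θ(c,0) e ∧ 0 = 0ₑ, so the
-- principal congruences of A_e at c lie inside those of A: centrality in A
-- gives centrality in A_e. Conversely, projecting θ(c,0) and θ(c,1) to A_e
-- lands in θₑ(c,0ₑ) and θₑ(c,1ₑ), while projecting θ(c,0) to A_e′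
-- collapses it since e′ ∧ c = e′ ∧ 0. In both directions the composition
-- of the two congruences is full because of the Church term q.
module Submission where

open import Defs
open import Data.Product using (_×_; _,_; proj₁; Σ-syntax)
open import Data.Unit.Polymorphic using (⊤; tt)
open import Function.Bundles using (_⇔_; mk⇔)
open import Relation.Binary.PropositionalEquality
  using (_≡_; refl; sym; trans; cong; cong₂; subst₂; module ≡-Reasoning)

module PrincipalCongruence {ℓ} {A : Set ℓ} (U : A → Set ℓ)
         (_+_ : A → A → A) (_′ : A → A) (o : A) where

  θ : A → A → A → A → Set ℓ
  θ = Θ U _+_ _′ o

  Q : A → A → A → A
  Q a y x = (((a + x) ′) + (((a ′) + y) ′)) ′

  θ-Q : ∀ {a b x x′ y y′ z z′} → θ a b x x′ → θ a b y y′ → θ a b z z′ →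
        θ a b (Q x y z) (Q x′ y′ z′)
  θ-Q p q r = θ′ (θ+ (θ′ (θ+ p r)) (θ′ (θ+ (θ′ p) q)))

  θ-diagonal : ∀ {a x y} → θ a a x y → x ≡ y
  θ-diagonal gen          = refl
  θ-diagonal (θrefl _)    = refl
  θ-diagonal (θsym p)     = sym (θ-diagonal p)
  θ-diagonal (θtrans p q) = trans (θ-diagonal p) (θ-diagonal q)
  θ-diagonal (θ+ p q)     = cong₂ _+_ (θ-diagonal p) (θ-diagonal q)
  θ-diagonal (θ′ p)       = cong _′ (θ-diagonal p)

  θ-least : ∀ {a b a′ b′ x y} → θ a′ b′ a b → θ a b x y → θ a′ b′ x y
  θ-least r gen          = r
  θ-least r (θrefl u)    = θrefl u
  θ-least r (θsym p)     = θsym (θ-least r p)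
  θ-least r (θtrans p q) = θtrans (θ-least r p) (θ-least r q)
  θ-least r (θ+ p q)     = θ+ (θ-least r p) (θ-least r q)
  θ-least r (θ′ p)       = θ′ (θ-least r p)

  composition-full :
    (∀ x y → U x → U y → Q (o ′) y x ≡ x) →
    (∀ x y → U x → U y → Q o y x ≡ y) →
    ∀ c → (∀ x y → U x → U y → U (Q c y x)) →
    ∀ x y → U x → U y → Σ[ z ∈ A ] (U z × θ c (o ′) x z × θ c o z y)
  composition-full Q-zero Q-one c Q-closed x y ux uy =
    Q c y x , Q-closed x y ux uy ,
    θsym (subst₂ (θ c (o ′)) refl (Q-zero x y ux uy) Q-c-θ) ,
    subst₂ (θ c o) refl (Q-one x y ux uy) Q-c-θ
    where
    Q-c-θ : ∀ {d} → θ c d (Q c y x) (Q d y x)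
    Q-c-θ = θ-Q gen (θrefl uy) (θrefl ux)

module _ {ℓ} (𝐀 : ZeroCommOrthogroupoid ℓ) where
  open ZeroCommOrthogroupoid 𝐀
  open ≡-Reasoning

  module 𝔸 = PrincipalCongruence {A = Carrier} (λ _ → ⊤) _+_ _′ one
  module 𝔸ₑ (g : Carrier) =
    PrincipalCongruence (InAₑ 𝐀 g) (_+ₑ_ 𝐀 g) (′ₑ 𝐀 g) (oneₑ 𝐀 g)

  zeroₑ : Carrier → Carrier
  zeroₑ g = ′ₑ 𝐀 g (oneₑ 𝐀 g)

  one-+ : ∀ y → one + y ≡ one
  one-+ y = quasi one (one + y) (absorb₁ one y) (zero-+ (one + y))

  zero′ : zero ′ ≡ one
  zero′ = involutive one

  one-∧ : ∀ x → one ∧ x ≡ x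
  one-∧ x = begin
    ((one + zero) ′ + (zero + x) ′) ′  ≡⟨ cong (λ w → (w ′ + (zero + x) ′) ′) (one-+ zero) ⟩
    (zero + (zero + x) ′) ′            ≡⟨ cong (λ w → (zero + w ′) ′) (zero-+ x) ⟩
    (zero + x ′) ′                      ≡⟨ cong _′ (zero-+ (x ′)) ⟩
    x ′ ′                               ≡⟨ involutive x ⟩
    x                                   ∎

  Q-one : ∀ x y → 𝔸.Q one y x ≡ y
  Q-one x y = begin
    ((one + x) ′ + (zero + y) ′) ′ ≡⟨ cong (λ w → (w ′ + (zero + y) ′) ′) (one-+ x) ⟩
    (zero + (zero + y) ′) ′        ≡⟨ cong (λ w → (zero + w ′) ′) (zero-+ y) ⟩
    (zero + y ′) ′                  ≡⟨ cong _′ (zero-+ (y ′)) ⟩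
    y ′ ′                           ≡⟨ involutive y ⟩
    y                               ∎

  Q-zero : ∀ x y → 𝔸.Q zero y x ≡ x
  Q-zero x y = begin
    ((zero + x) ′ + (zero ′ + y) ′) ′ ≡⟨ cong₂ (λ u w → (u ′ + (w + y) ′) ′) (zero-+ x) zero′ ⟩
    (x ′ + (one + y) ′) ′             ≡⟨ cong (λ w → (x ′ + w ′) ′) (one-+ y) ⟩
    (x ′ + zero) ′                    ≡⟨ cong _′ (zero-comm (x ′)) ⟩
    (zero + x ′) ′                    ≡⟨ cong _′ (zero-+ (x ′)) ⟩
    x ′ ′                             ≡⟨ involutive x ⟩
    x                                 ∎

  zero-∧ : ∀ x → zero ∧ x ≡ zero
  zero-∧ x = Q-zero zero x

  θ-∧ : ∀ {g a b x y} → 𝔸.θ a b x y → 𝔸.θ a b (g ∧ x) (g ∧ y)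
  θ-∧ p = 𝔸.θ-Q (θrefl tt) p (θrefl tt)

  θₑ⇒θ : ∀ {g a b x y} → 𝔸ₑ.θ g a b x y → 𝔸.θ a b x y
  θₑ⇒θ gen          = gen
  θₑ⇒θ (θrefl _)    = θrefl tt
  θₑ⇒θ (θsym p)     = θsym (θₑ⇒θ p)
  θₑ⇒θ (θtrans p q) = θtrans (θₑ⇒θ p) (θₑ⇒θ q)
  θₑ⇒θ (θ+ p q)     = θ-∧ (θ+ (θₑ⇒θ p) (θₑ⇒θ q))
  θₑ⇒θ (θ′ p)       = θ-∧ (θ′ (θₑ⇒θ p))

  record IsProjectionHom (g : Carrier) : Set ℓ where
    field
      ∧-+ : ∀ x u → g ∧ (x + u) ≡ _+ₑ_ 𝐀 g (g ∧ x) (g ∧ u)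
      ∧-′ : ∀ x → g ∧ (x ′) ≡ ′ₑ 𝐀 g (g ∧ x)

  θ-project : ∀ {g a b x y} → IsProjectionHom g → 𝔸.θ a b x y →
              𝔸ₑ.θ g (g ∧ a) (g ∧ b) (g ∧ x) (g ∧ y)
  θ-project h gen              = gen
  θ-project h (θrefl {x} _)    = θrefl (x , refl)
  θ-project h (θsym p)         = θsym (θ-project h p)
  θ-project h (θtrans p q)     = θtrans (θ-project h p) (θ-project h q)
  θ-project h (θ+ {x} {y} {u} {v} p q) =
    subst₂ (𝔸ₑ.θ _ _ _) (sym (∧-+ x u)) (sym (∧-+ y v))
      (θ+ (θ-project h p) (θ-project h q))
    where open IsProjectionHom h
  θ-project h (θ′ {x} {y} p) =
    subst₂ (𝔸ₑ.θ _ _ _) (sym (∧-′ x)) (sym (∧-′ y)) (θ′ (θ-project h p))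
    where open IsProjectionHom h

  infixl 6 _⊕_
  infix 8 _ᶜ
  infixr 7 var∧_ var′∧_

  data Term : Set ℓ where
    var    : Term
    con    : Carrier → Term
    _⊕_    : Term → Term → Term
    _ᶜ     : Term → Term
    var∧_  : Term → Term
    var′∧_ : Term → Term

  ⟦_⟧ : Term → Carrier → Carrier
  ⟦ var ⟧      a = a
  ⟦ con x ⟧    a = x
  ⟦ t ⊕ s ⟧    a = ⟦ t ⟧ a + ⟦ s ⟧ a
  ⟦ t ᶜ ⟧      a = ⟦ t ⟧ a ′
  ⟦ var∧ t ⟧   a = a ∧ ⟦ t ⟧ a
  ⟦ var′∧ t ⟧  a = a ′ ∧ ⟦ t ⟧ a

  -- The values at one and at zero with the guards already simplified, so that
  -- the Boolean hypotheses of agree-at-central below mostly hold by refl.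
  ⟦_⟧¹ : Term → Carrier
  ⟦ var ⟧¹     = one
  ⟦ con x ⟧¹   = x
  ⟦ t ⊕ s ⟧¹   = ⟦ t ⟧¹ + ⟦ s ⟧¹
  ⟦ t ᶜ ⟧¹     = ⟦ t ⟧¹ ′
  ⟦ var∧ t ⟧¹  = ⟦ t ⟧¹
  ⟦ var′∧ t ⟧¹ = zero

  ⟦_⟧⁰ : Term → Carrier
  ⟦ var ⟧⁰     = zero
  ⟦ con x ⟧⁰   = x
  ⟦ t ⊕ s ⟧⁰   = ⟦ t ⟧⁰ + ⟦ s ⟧⁰
  ⟦ t ᶜ ⟧⁰     = ⟦ t ⟧⁰ ′
  ⟦ var∧ t ⟧⁰  = zero
  ⟦ var′∧ t ⟧⁰ = ⟦ t ⟧⁰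

  ⟦⟧-one : ∀ t → ⟦ t ⟧ one ≡ ⟦ t ⟧¹
  ⟦⟧-one var         = refl
  ⟦⟧-one (con x)     = refl
  ⟦⟧-one (t ⊕ s)     = cong₂ _+_ (⟦⟧-one t) (⟦⟧-one s)
  ⟦⟧-one (t ᶜ)       = cong _′ (⟦⟧-one t)
  ⟦⟧-one (var∧ t)    = trans (one-∧ _) (⟦⟧-one t)
  ⟦⟧-one (var′∧ t)   = zero-∧ _

  ⟦⟧-zero : ∀ t → ⟦ t ⟧ zero ≡ ⟦ t ⟧⁰
  ⟦⟧-zero var        = refl
  ⟦⟧-zero (con x)    = refl
  ⟦⟧-zero (t ⊕ s)    = cong₂ _+_ (⟦⟧-zero t) (⟦⟧-zero s)
  ⟦⟧-zero (t ᶜ)      = cong _′ (⟦⟧-zero t)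
  ⟦⟧-zero (var∧ t)   = zero-∧ _
  ⟦⟧-zero (var′∧ t)  = begin
    zero ′ ∧ ⟦ t ⟧ zero ≡⟨ cong (_∧ ⟦ t ⟧ zero) zero′ ⟩
    one ∧ ⟦ t ⟧ zero    ≡⟨ one-∧ _ ⟩
    ⟦ t ⟧ zero          ≡⟨ ⟦⟧-zero t ⟩
    ⟦ t ⟧⁰              ∎

  θ-⟦⟧ : ∀ t {a b} → 𝔸.θ a b (⟦ t ⟧ a) (⟦ t ⟧ b)
  θ-⟦⟧ var       = gen
  θ-⟦⟧ (con x)   = θrefl tt
  θ-⟦⟧ (t ⊕ s)   = θ+ (θ-⟦⟧ t) (θ-⟦⟧ s)
  θ-⟦⟧ (t ᶜ)     = θ′ (θ-⟦⟧ t)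
  θ-⟦⟧ (var∧ t)  = 𝔸.θ-Q gen (θ-⟦⟧ t) (θrefl tt)
  θ-⟦⟧ (var′∧ t) = 𝔸.θ-Q (θ′ gen) (θ-⟦⟧ t) (θrefl tt)

  θ-⟦⟧¹ : ∀ t {e} → 𝔸.θ e one (⟦ t ⟧ e) ⟦ t ⟧¹
  θ-⟦⟧¹ t = subst₂ (𝔸.θ _ one) refl (⟦⟧-one t) (θ-⟦⟧ t)

  θ-⟦⟧⁰ : ∀ t {e} → 𝔸.θ e zero (⟦ t ⟧ e) ⟦ t ⟧⁰
  θ-⟦⟧⁰ t = subst₂ (𝔸.θ _ zero) refl (⟦⟧-zero t) (θ-⟦⟧ t)

  module CentralElement (e : Carrier) (e-central : Central 𝐀 e) where

    agree-at-central : ∀ t s → ⟦ t ⟧⁰ ≡ ⟦ s ⟧⁰ → ⟦ t ⟧¹ ≡ ⟦ s ⟧¹ → ⟦ t ⟧ e ≡ ⟦ s ⟧ e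
    agree-at-central t s t⁰≡s⁰ t¹≡s¹ = proj₁ e-central _ _ tt tt
      (θtrans (θ-⟦⟧⁰ t) (subst₂ (𝔸.θ e zero) (sym t⁰≡s⁰) refl (θsym (θ-⟦⟧⁰ s))))
      (θtrans (θ-⟦⟧¹ t) (subst₂ (𝔸.θ e one) (sym t¹≡s¹) refl (θsym (θ-⟦⟧¹ s))))

    ∧-idem : ∀ x → e ∧ (e ∧ x) ≡ e ∧ x
    ∧-idem x = agree-at-central (var∧ var∧ con x) (var∧ con x) refl refl

    ∧-isProjectionHom : IsProjectionHom e
    ∧-isProjectionHom = record
      { ∧-+ = λ x u → agree-at-central (var∧ (con x ⊕ con u))
                        (var∧ (var∧ con x ⊕ var∧ con u)) refl refl
      ; ∧-′ = λ x → agree-at-central (var∧ con x ᶜ) (var∧ (var∧ con x) ᶜ) refl refl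
      }

    ′∧-isProjectionHom : IsProjectionHom (e ′)
    ′∧-isProjectionHom = record
      { ∧-+ = λ x u → agree-at-central (var′∧ (con x ⊕ con u))
                        (var′∧ (var′∧ con x ⊕ var′∧ con u)) refl refl
      ; ∧-′ = λ x → agree-at-central (var′∧ con x ᶜ) (var′∧ (var′∧ con x) ᶜ) refl refl
      }

    ∧-fixes-Aₑ : ∀ {c} → InAₑ 𝐀 e c → e ∧ c ≡ c
    ∧-fixes-Aₑ (x , refl) = ∧-idem x

    ′∧-collapses-Aₑ : ∀ {c} → InAₑ 𝐀 e c → e ′ ∧ c ≡ e ′ ∧ zero
    ′∧-collapses-Aₑ (x , refl) =
      agree-at-central (var′∧ var∧ con x) (var′∧ con zero) refl refl

    ∧-zero : e ∧ zero ≡ zeroₑ e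
    ∧-zero = IsProjectionHom.∧-′ ∧-isProjectionHom one

    determined-by-∧ : ∀ x y → e ∧ x ≡ e ∧ y → e ′ ∧ x ≡ e ′ ∧ y → x ≡ y
    determined-by-∧ x y ∧-eq ′∧-eq = proj₁ e-central x y tt tt
      (θtrans (θsym (θ-⟦⟧⁰ (var′∧ con x)))
        (subst₂ (𝔸.θ e zero) (sym ′∧-eq) refl (θ-⟦⟧⁰ (var′∧ con y))))
      (θtrans (θsym (θ-⟦⟧¹ (var∧ con x)))
        (subst₂ (𝔸.θ e one) (sym ∧-eq) refl (θ-⟦⟧¹ (var∧ con y))))

    Qᵗ : Term → Term → Term → Term
    Qᵗ a y x = ′ᵗ (′ᵗ (a +ᵗ x) +ᵗ ′ᵗ (′ᵗ a +ᵗ y))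
      where
      _+ᵗ_ : Term → Term → Term
      t +ᵗ s = var∧ (t ⊕ s)
      ′ᵗ : Term → Term
      ′ᵗ t = var∧ t ᶜ

    Qₑ-zero : ∀ x y → InAₑ 𝐀 e x → InAₑ 𝐀 e y → 𝔸ₑ.Q e (zeroₑ e) y x ≡ x
    Qₑ-zero _ _ (x , refl) (y , refl) = agree-at-central
      (Qᵗ (var∧ (var∧ con one) ᶜ) (var∧ con y) (var∧ con x)) (var∧ con x)
      refl (Q-zero x y)

    Qₑ-one : ∀ x y → InAₑ 𝐀 e x → InAₑ 𝐀 e y → 𝔸ₑ.Q e (oneₑ 𝐀 e) y x ≡ y
    Qₑ-one _ _ (x , refl) (y , refl) = agree-at-central
      (Qᵗ (var∧ con one) (var∧ con y) (var∧ con x)) (var∧ con y)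
      refl (Q-one x y)

    module _ (c : Carrier) (c∈Aₑ : InAₑ 𝐀 e c) where

      central⇒centralₑ : Central 𝐀 c → Centralₑ 𝐀 e c
      central⇒centralₑ c-central =
        intersection ,
        𝔸ₑ.composition-full e Qₑ-zero Qₑ-one c (λ _ _ _ _ → _ , refl)
        where
        c-θ-zeroₑ : 𝔸.θ c zero c (zeroₑ e)
        c-θ-zeroₑ = subst₂ (𝔸.θ c zero) (∧-fixes-Aₑ c∈Aₑ) ∧-zero (θ-∧ gen)

        c-θ-oneₑ : 𝔸.θ c one c (oneₑ 𝐀 e)
        c-θ-oneₑ = subst₂ (𝔸.θ c one) (∧-fixes-Aₑ c∈Aₑ) refl (θ-∧ gen)

        intersection : ∀ x y → InAₑ 𝐀 e x → InAₑ 𝐀 e y →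
                       𝔸ₑ.θ e c (zeroₑ e) x y → 𝔸ₑ.θ e c (oneₑ 𝐀 e) x y → x ≡ y
        intersection x y _ _ p q = proj₁ c-central x y tt tt
          (𝔸.θ-least c-θ-zeroₑ (θₑ⇒θ p)) (𝔸.θ-least c-θ-oneₑ (θₑ⇒θ q))

      centralₑ⇒central : Centralₑ 𝐀 e c → Central 𝐀 c
      centralₑ⇒central c-centralₑ =
        intersection ,
        𝔸.composition-full (λ x y _ _ → Q-zero x y) (λ x y _ _ → Q-one x y) c
          (λ _ _ _ _ → tt)
        where
        intersection : ∀ x y → ⊤ → ⊤ → 𝔸.θ c zero x y → 𝔸.θ c one x y → x ≡ y
        intersection x y _ _ p q = determined-by-∧ x y ∧-eq ′∧-eq
          where
          ∧-eq : e ∧ x ≡ e ∧ y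
          ∧-eq = proj₁ c-centralₑ _ _ (x , refl) (y , refl)
            (subst₂ (λ a b → 𝔸ₑ.θ e a b (e ∧ x) (e ∧ y)) (∧-fixes-Aₑ c∈Aₑ) ∧-zero
              (θ-project ∧-isProjectionHom p))
            (subst₂ (λ a b → 𝔸ₑ.θ e a b (e ∧ x) (e ∧ y)) (∧-fixes-Aₑ c∈Aₑ) refl
              (θ-project ∧-isProjectionHom q))

          ′∧-eq : e ′ ∧ x ≡ e ′ ∧ y
          ′∧-eq = 𝔸ₑ.θ-diagonal (e ′)
            (subst₂ (λ a b → 𝔸ₑ.θ (e ′) a b (e ′ ∧ x) (e ′ ∧ y)) (′∧-collapses-Aₑ c∈Aₑ) refl
              (θ-project ′∧-isProjectionHom p))

proposition3p9 : ∀ {ℓ} (𝐀 : ZeroCommOrthogroupoid ℓ)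
    (e : ZeroCommOrthogroupoid.Carrier 𝐀) → Central 𝐀 e →
    (c : ZeroCommOrthogroupoid.Carrier 𝐀) → InAₑ 𝐀 e c →
    Central 𝐀 c ⇔ Centralₑ 𝐀 e c
proposition3p9 𝐀 e e-central c c∈Aₑ =
  mk⇔ (central⇒centralₑ c c∈Aₑ) (centralₑ⇒central c c∈Aₑ)
  where open CentralElement 𝐀 e e-central
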